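{- Let $V$ be a locally $U$-small type with an equivalence $\sup:\mathcal{P}_U V\simeq V$, and for $x:V$ and $y\equiv\sup(A,f)$ define $x\in y:=\sum_{a:A}f\,a=x$. Then for every $x:V$ and every $P:V\to\mathrm{Prop}_U$ there is $u:V$ such that for all $z:V$, $(z\in u)\simeq (z\in x)\times P\,z$.
   Context: Homotopy type theory with a univalent universe $U$ inside a larger univalent universe $\mathrm{Type}$; $\mathrm{Prop}_U$ is the type of mere propositions in $U$. A type is locally $U$-small if each of its identity types is equivalent to a type in $U$. $A\hookrightarrow B$ denotes embeddings. $\mathcal{P}_U X:=\sum_{A:U}(A\hookrightarrow X)$. Every $y:V$ is of the form $\sup(A,f)$ since $\sup$ is an equivalence. -}

{-# OPTIONS --without-K #-}
module Defs where

open import Level using (Level; _⊔_) renaming (suc to lsuc)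
open import Data.Product using (Σ; _×_; _,_; proj₁; proj₂)
open import Relation.Binary.PropositionalEquality using (_≡_; refl; cong)

_∼_ : ∀ {a b} {A : Set a} {B : A → Set b} → ((x : A) → B x) → ((x : A) → B x) → Set (a ⊔ b)
f ∼ g = ∀ x → f x ≡ g x

-- bi-invertible maps (a proposition, equivalent to contractible fibres)
isEquiv : ∀ {a b} {A : Set a} {B : Set b} → (A → B) → Set (a ⊔ b)
isEquiv {A = A} {B} f =
  (Σ (B → A) λ g → (λ x → g (f x)) ∼ (λ x → x)) ×
  (Σ (B → A) λ h → (λ y → f (h y)) ∼ (λ y → y))

_≃_ : ∀ {a b} → Set a → Set b → Set (a ⊔ b)
A ≃ B = Σ (A → B) isEquiv

infix 4 _≃_

⌜_⌝ : ∀ {a b} {A : Set a} {B : Set b} → A ≃ B → A → B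
⌜ e ⌝ = proj₁ e

⌜_⌝⁻¹ : ∀ {a b} {A : Set a} {B : Set b} → A ≃ B → B → A
⌜ e ⌝⁻¹ = proj₁ (proj₂ (proj₂ e))

idtoeqv : ∀ {ℓ} {A B : Set ℓ} → A ≡ B → A ≃ B
idtoeqv refl = (λ x → x) , ((λ x → x) , λ _ → refl) , ((λ x → x) , λ _ → refl)

Univalence : (ℓ : Level) → Set (lsuc ℓ)
Univalence ℓ = (A B : Set ℓ) → isEquiv (idtoeqv {ℓ} {A} {B})

isProp : ∀ {a} → Set a → Set a
isProp A = (x y : A) → x ≡ y

Prop : (ℓ : Level) → Set (lsuc ℓ)
Prop ℓ = Σ (Set ℓ) isProp

isEmbedding : ∀ {a b} {A : Set a} {B : Set b} → (A → B) → Set (a ⊔ b)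
isEmbedding {A = A} f = (x y : A) → isEquiv (cong f {x} {y})

_↪_ : ∀ {a b} → Set a → Set b → Set (a ⊔ b)
A ↪ B = Σ (A → B) isEmbedding

𝒫 : (ℓ : Level) → ∀ {t} → Set t → Set (lsuc ℓ ⊔ t)
𝒫 ℓ X = Σ (Set ℓ) λ A → A ↪ X

isLocallySmall : (ℓ : Level) → ∀ {t} → Set t → Set (lsuc ℓ ⊔ t)
isLocallySmall ℓ X = (x y : X) → Σ (Set ℓ) λ T → T ≃ (x ≡ y)

-- membership: x ∈ y := Σ (a : A) (f a ≡ x), where (A , f) is sup⁻¹ y,
-- i.e. y ≡ sup (A , f)
member : ∀ {ℓ t} {V : Set t} → (𝒫 ℓ V ≃ V) → V → V → Set (ℓ ⊔ t)
member sup x y with ⌜ sup ⌝⁻¹ y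
... | A , f , _ = Σ A λ a → f a ≡ x

{-# OPTIONS --without-K #-}
-- Separation holds by restricting the subset coded by x: if sup⁻¹ x = (A , f), then
-- (Σ a ꞉ A , P (f a)) ↪ V via f ∘ proj₁ is again a U-small subset, being a composite of
-- embeddings (projections out of families of propositions are embeddings), and sup
-- turns it into the required u.
module Submission where

open import Defs
open import Level using (Level; _⊔_)
open import Function using (_∘_)
open import Data.Product using (Σ; _×_; proj₁; proj₂; _,_)
open import Relation.Binary.PropositionalEquality using (_≡_; refl; sym; trans; cong; subst)
open import Relation.Binary.PropositionalEquality.Properties using (trans-symˡ; cong-∘)

private
  variable
    a b c ℓ t : Level
    A : Set a
    B : Set b
    C : Set c

≃-refl : A ≃ A
≃-refl = (λ x → x) , ((λ x → x) , λ _ → refl) , ((λ x → x) , λ _ → refl)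

≃-trans : A ≃ B → B ≃ C → A ≃ C
≃-trans (f , (g , gf) , (h , fh)) (f′ , (g′ , gf′) , (h′ , fh′)) =
  f′ ∘ f ,
  (g ∘ g′ , λ x → trans (cong g (gf′ (f x))) (gf x)) ,
  (h ∘ h′ , λ z → trans (cong f′ (fh (h′ z))) (fh′ z))

isEquiv-∼ : {f k : A → B} → k ∼ f → isEquiv f → isEquiv k
isEquiv-∼ k∼f ((g , gf) , (h , fh)) =
  (g , λ x → trans (cong g (k∼f x)) (gf x)) ,
  (h , λ y → trans (k∼f (h y)) (fh y))

⌜⌝⁻¹∘⌜⌝ : (e : A ≃ B) → (⌜ e ⌝⁻¹ ∘ ⌜ e ⌝) ∼ (λ x → x)
⌜⌝⁻¹∘⌜⌝ (f , (g , gf) , (h , fh)) x =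
  trans (sym (gf (h (f x)))) (trans (cong g (fh (f x))) (gf x))

isEmbedding-∘ : {f : B → C} {g : A → B} → isEmbedding f → isEmbedding g → isEmbedding (f ∘ g)
isEmbedding-∘ {f = f} {g} f-emb g-emb x y =
  isEquiv-∼ cong-∘ (proj₂ (≃-trans (cong g , g-emb x y) (cong f , f-emb (g x) (g y))))

isEmbedding-proj₁ : {Q : A → Set b} → (∀ x → isProp (Q x)) → isEmbedding (proj₁ {B = Q})
isEmbedding-proj₁ {A = A} {Q = Q} Q-prop (x , p) (y , q) =
  (lift , lift∘cong-proj₁) , (lift , cong-proj₁∘lift)
  where
  -- Q-prop itself need not send p ≡ p to refl; this renormalised path does.
  prop-path : ∀ {x} (p q : Q x) → p ≡ q
  prop-path {x} p q = trans (sym (Q-prop x p p)) (Q-prop x p q)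

  prop-path-refl : ∀ {x} (p : Q x) → prop-path p p ≡ refl
  prop-path-refl {x} p = trans-symˡ (Q-prop x p p)

  cong-proj₁-cong-, : ∀ {x} {p q : Q x} (r : p ≡ q) → cong proj₁ (cong (_,_ {B = Q} x) r) ≡ refl
  cong-proj₁-cong-, refl = refl

  lift : ∀ {y q} → x ≡ y → _≡_ {A = Σ A Q} (x , p) (y , q)
  lift {q = q} refl = cong (x ,_) (prop-path p q)

  lift∘cong-proj₁ : (e : (x , p) ≡ (y , q)) → lift (cong proj₁ e) ≡ e
  lift∘cong-proj₁ refl = cong (cong (x ,_)) (prop-path-refl p)

  cong-proj₁∘lift : (e : x ≡ y) → cong proj₁ (lift {q = q} e) ≡ e
  cong-proj₁∘lift refl = cong-proj₁-cong-, (prop-path p q)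

_∈𝒫_ : {V : Set t} → V → 𝒫 ℓ V → Set (ℓ ⊔ t)
z ∈𝒫 (A , f , _) = Σ A λ a → f a ≡ z

∈𝒫-subst : {V : Set t} {X Y : 𝒫 ℓ V} → X ≡ Y → (z : V) → z ∈𝒫 X ≃ z ∈𝒫 Y
∈𝒫-subst refl z = ≃-refl

member-sup : {V : Set t} (sup : 𝒫 ℓ V ≃ V) (X : 𝒫 ℓ V) (z : V) → member sup z (⌜ sup ⌝ X) ≃ z ∈𝒫 X
member-sup sup X = ∈𝒫-subst (⌜⌝⁻¹∘⌜⌝ sup X)

𝒫-restrict : {V : Set t} → 𝒫 ℓ V → (V → Prop ℓ) → 𝒫 ℓ V
𝒫-restrict (A , f , f-emb) P =
  (Σ A λ a → proj₁ (P (f a))) ,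
  f ∘ proj₁ ,
  isEmbedding-∘ f-emb (isEmbedding-proj₁ (λ a → proj₂ (P (f a))))

∈𝒫-restrict : {V : Set t} (X : 𝒫 ℓ V) (P : V → Prop ℓ) (z : V)
            → z ∈𝒫 𝒫-restrict X P ≃ (z ∈𝒫 X × proj₁ (P z))
∈𝒫-restrict X@(A , f , _) P z = to , (from , from∘to) , (from , to∘from)
  where
  to : z ∈𝒫 𝒫-restrict X P → z ∈𝒫 X × proj₁ (P z)
  to ((a , p) , fa≡z) = (a , fa≡z) , subst (proj₁ ∘ P) fa≡z p

  from : z ∈𝒫 X × proj₁ (P z) → z ∈𝒫 𝒫-restrict X P
  from ((a , fa≡z) , p) = (a , subst (proj₁ ∘ P) (sym fa≡z) p) , fa≡z

  from∘to : (from ∘ to) ∼ (λ w → w)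
  from∘to ((a , p) , fa≡z) = cong (λ r → (a , r) , fa≡z) (proj₂ (P (f a)) _ _)

  to∘from : (to ∘ from) ∼ (λ w → w)
  to∘from ((a , fa≡z) , p) = cong ((a , fa≡z) ,_) (proj₂ (P z) _ _)

mainTheorem6 : {ℓ t : Level} → Univalence ℓ → Univalence t
    → (V : Set t) → isLocallySmall ℓ V → (sup : 𝒫 ℓ V ≃ V)
    → (x : V) (P : V → Prop ℓ)
    → Σ V λ u → (z : V) → member sup z u ≃ (member sup z x × proj₁ (P z))
mainTheorem6 _ _ V _ sup x P =
  ⌜ sup ⌝ X∩P , λ z → ≃-trans (member-sup sup X∩P z) (∈𝒫-restrict X P z)
  where
  X : 𝒫 _ V
  X = ⌜ sup ⌝⁻¹ x

  X∩P : 𝒫 _ V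
  X∩P = 𝒫-restrict X P
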